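{- Let $T$ be any AVL tree with $n$ nodes (a binary search tree on $n$ distinct keys, together with the ranks required by the AVL rank rule). Then there is an ordering of the $n$ keys of $T$ such that, starting from the empty tree and inserting these keys one by one in that order using the AVL insertion algorithm described below, the final tree is exactly $T$ (same shape, same keys, same ranks), and every one of these $n$ insertions performs only promotions during rebalancing (no single or double rotations).
   Context: A ranked binary tree is a binary tree in which each node $x$ has a non-negative integer rank $x.r$; a missing node (absent child) has rank $-1$. For a child $x$ with parent $p$, its rank difference is $p.r - x.r$; a child with rank difference $i$ is an $i$-child, and a node whose two children (possibly missing) have rank differences $i \le j$ is an $i,j$ node. An AVL tree is a ranked binary tree in which every node is $1,1$ or $1,2$ (so leaves have rank $0$ and ranks equal heights). The trees are binary search trees: nodes carry distinct keys in symmetric (in-)order. AVL insertion of a new key: replace the missing node at the position determined by binary search for the key with a new leaf of rank $0$. Then, while some node $p$ has a $0$-child $x$ (a violation), apply: (Promotion) if the sibling of $x$ is a $1$-child of $p$ (so $p$ is $0,1$), increase $p.r$ by $1$ and continue checking at $p$'s parent; otherwise $p$ is $0,2$, and let $z$ be the child of $x$ on the side opposite to the side $x$ is on relative to $p$: (Single rotation) if $z$ is missing-or-a-$2$-child of $x$, rotate at $x$ (making $x$ the parent of $p$) and decrease $p.r$ by $1$, then stop; (Double rotation) otherwise ($z$ is a $1$-child of $x$), do a double rotation making $z$ the parent of both $x$ and $p$, increase $z.r$ by $1$ and decrease both $x.r$ and $p.r$ by $1$, then stop. A rotation is the standard local restructuring preserving symmetric order. -}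

module Defs where

open import Data.Nat using (ℕ; zero; suc; _<_; _<ᵇ_)
open import Data.Integer as ℤ using (ℤ; +_; -[1+_])
open import Data.Bool using (Bool; true; false; _∨_; if_then_else_)
open import Data.List using (List; []; _∷_; _++_; foldl)
open import Data.Product using (_×_; _,_; proj₁; proj₂)
open import Relation.Binary.PropositionalEquality using (_≡_)
open import Relation.Nullary using (does)

-- Ranked binary search trees with natural-number keys.
-- node l k r t : left subtree l, key k, rank r, right subtree t.
-- leaf is the missing node.
data Tree : Set where
  leaf : Tree
  node : Tree → ℕ → ℕ → Tree → Tree

rk : Tree → ℤ
rk leaf             = -[1+ 0 ]
rk (node _ _ r _)   = + r

keys : Tree → List ℕ
keys leaf           = []
keys (node l k _ t) = keys l ++ (k ∷ keys t)

size : Tree → ℕ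
size leaf           = 0
size (node l _ _ t) = suc (size l Data.Nat.+ size t)

data Sorted : List ℕ → Set where
  []  : Sorted []
  [_] : ∀ x → Sorted (x ∷ [])
  _∷_ : ∀ {x y ys} → x < y → Sorted (y ∷ ys) → Sorted (x ∷ y ∷ ys)

BST : Tree → Set
BST t = Sorted (keys t)

rdiff : ℕ → Tree → ℤ
rdiff r c = + r ℤ.- rk c

data OneOneOrOneTwo : ℤ → ℤ → Set where
  d11 : OneOneOrOneTwo (+ 1) (+ 1)
  d12 : OneOneOrOneTwo (+ 1) (+ 2)
  d21 : OneOneOrOneTwo (+ 2) (+ 1)

data AVLRanks : Tree → Set where
  leaf : AVLRanks leaf
  node : ∀ {l k r t} → AVLRanks l → AVLRanks t →
         OneOneOrOneTwo (rdiff r l) (rdiff r t) → AVLRanks (node l k r t)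

AVL : Tree → Set
AVL t = BST t × AVLRanks t

-- After inserting into a child subtree, the only possible violation is
-- that the new child root is a 0-child of the current node; it is fixed
-- here by promotion (propagates upward), single or double rotation
-- (stops).  The Bool result records whether any rotation (single or
-- double) was performed during this insertion.

isDiff : ℤ → ℕ → Tree → Bool
isDiff i r c = does (rdiff r c ℤ.≟ i)

-- left child x = node a xk xr b (a 0-child of p = node x pk pr t, t its sibling)
fixLeft : Tree → ℕ → ℕ → Tree → Tree × Bool
fixLeft leaf pk pr t = node leaf pk pr t , false   -- impossible case
fixLeft x@(node a xk xr b) pk pr t with isDiff (+ 0) pr x
... | false = node x pk pr t , false
... | true with isDiff (+ 1) pr t
...   | true = node x pk (suc pr) t , false        -- promotion
...   | false with isDiff (+ 1) xr b
...     | false = node a xk xr (node b pk (pred pr) t) , true  -- single rotation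
  where pred : ℕ → ℕ
        pred zero = zero
        pred (suc n) = n
...     | true with b
...       | leaf = node x pk pr t , true            -- impossible case
...       | node c zk zr d =
              node (node a xk (pred xr) c) zk (suc zr) (node d pk (pred pr) t) , true
  where pred : ℕ → ℕ
        pred zero = zero
        pred (suc n) = n

-- mirror image: right child x = node b xk xr a is a 0-child of p = node t pk pr x
fixRight : Tree → ℕ → ℕ → Tree → Tree × Bool
fixRight t pk pr leaf = node t pk pr leaf , false   -- impossible case
fixRight t pk pr x@(node b xk xr a) with isDiff (+ 0) pr x
... | false = node t pk pr x , false
... | true with isDiff (+ 1) pr t
...   | true = node t pk (suc pr) x , false         -- promotion
...   | false with isDiff (+ 1) xr b
...     | false = node (node t pk (pred pr) b) xk xr a , true  -- single rotation
  where pred : ℕ → ℕ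
        pred zero = zero
        pred (suc n) = n
...     | true with b
...       | leaf = node t pk pr x , true            -- impossible case
...       | node c zk zr d =
              node (node t pk (pred pr) c) zk (suc zr) (node d xk (pred xr) a) , true
  where pred : ℕ → ℕ
        pred zero = zero
        pred (suc n) = n

insert : ℕ → Tree → Tree × Bool
insert k leaf = node leaf k 0 leaf , false
insert k (node l x r t) with k <ᵇ x | x <ᵇ k
... | true  | _     = let (l' , b) = insert k l
                          (s , b') = fixLeft l' x r t
                      in s , (b ∨ b')
... | false | true  = let (t' , b) = insert k t
                          (s , b') = fixRight l x r t'
                      in s , (b ∨ b')
... | false | false = node l x r t , false

insertAll : List ℕ → Tree → Tree × Bool
insertAll []       t = t , false
insertAll (k ∷ ks) t = let (t' , b) = insert k t
                           (u , b') = insertAll ks t'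
                       in u , (b ∨ b')

module Submission where

-- Work with heights ht = rank + 1.  A *rise* is a sequence of rotation-free
-- insertions whose first step raises the height of the tree by one and
-- whose remaining steps keep it; Grow n s ks u says that ks splits into n
-- consecutive rises leading from s to u.  By induction on T, some ordering
-- of its keys is a Grow (ht T) from the empty tree: insert the root key
-- first; then, level by level, replay the next rise of the left subtree (a
-- promotion at the root) followed by the next rise of the right subtree
-- (absorbed without violation).  If one subtree is one level taller, its
-- last rise is replayed at the end and promotes the root once more.

open import Defs
open import Data.List using (List; []; _∷_; _++_)
open import Data.List.Properties using (++-assoc; ++-identityʳ)
open import Data.List.Relation.Unary.All using (All; []; _∷_; map)
open import Data.List.Relation.Unary.All.Properties using (++⁻)
open import Data.List.Relation.Binary.Permutation.Propositional
  using (_↭_; ↭-refl; ↭-sym; ↭-trans; ↭-reflexive; prep)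
open import Data.List.Relation.Binary.Permutation.Propositional.Properties
  using (++⁺; ++⁺ˡ; ++⁺ʳ; ++-comm; shift; shifts; All-resp-↭)
open import Data.Nat using (ℕ; zero; suc; _+_; _≤_; _<_)
open import Data.Nat.Properties
  using (+-comm; +-identityʳ; suc-injective; 1+n≰n; <-trans; <⇒≯;
         ≤-reflexive; _<?_)
open import Data.Integer as ℤ using (+_; _⊖_)
open import Data.Integer.Properties using ([1+m]⊖[1+n]≡m⊖n; m-n≡m⊖n)
open import Data.Bool using (true; false)
open import Data.Product using (Σ; _×_; _,_)
open import Function using (_⇔_; mk⇔; Equivalence)
open import Relation.Binary.PropositionalEquality
  using (_≡_; _≢_; refl; sym; trans; cong; subst)
open import Relation.Nullary.Decidable using (dec-true; dec-false)

ht : Tree → ℕ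
ht leaf             = 0
ht (node _ _ r _)   = suc r

⊖≡+⇔ : ∀ m n {d} → (m ⊖ n ≡ + d) ⇔ (n + d ≡ m)
⊖≡+⇔ m n = mk⇔ (to m n) (from n)
  where
  to : ∀ m n {d} → m ⊖ n ≡ + d → n + d ≡ m
  to m       zero    refl = refl
  to zero    (suc n) ()
  to (suc m) (suc n) e    = cong suc (to m n (trans (sym ([1+m]⊖[1+n]≡m⊖n m n)) e))

  from : ∀ n {d m} → n + d ≡ m → m ⊖ n ≡ + d
  from zero    refl = refl
  from (suc n) refl = trans ([1+m]⊖[1+n]≡m⊖n (n + _) n) (from n refl)

rdiff-ht : ∀ r c → rdiff r c ≡ suc r ⊖ ht c
rdiff-ht r leaf             = cong +_ (+-comm r 1)
rdiff-ht r (node _ _ xr _)  = trans (m-n≡m⊖n r xr) (sym ([1+m]⊖[1+n]≡m⊖n r xr))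

rdiff≡⇔ : ∀ r c {d} → (rdiff r c ≡ + d) ⇔ (d + ht c ≡ suc r)
rdiff≡⇔ r c {d} = mk⇔
  (λ e → trans (+-comm d (ht c)) (to (trans (sym (rdiff-ht r c)) e)))
  (λ e → trans (rdiff-ht r c) (from (trans (+-comm (ht c) d) e)))
  where open Equivalence (⊖≡+⇔ (suc r) (ht c))

isDiff-true : ∀ d r c → d + ht c ≡ suc r → isDiff (+ d) r c ≡ true
isDiff-true d r c e = dec-true (rdiff r c ℤ.≟ + d) (Equivalence.from (rdiff≡⇔ r c) e)

isDiff-false : ∀ d r c → d + ht c ≢ suc r → isDiff (+ d) r c ≡ false
isDiff-false d r c ne = dec-false (rdiff r c ℤ.≟ + d) (λ e → ne (Equivalence.to (rdiff≡⇔ r c) e))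

data Shape (hL hR r : ℕ) : Set where
  even      : hL ≡ r → hR ≡ r → Shape hL hR r
  leftTall  : hL ≡ r → suc hR ≡ r → Shape hL hR r
  rightTall : suc hL ≡ r → hR ≡ r → Shape hL hR r

rankRule : ∀ {r L R} → OneOneOrOneTwo (rdiff r L) (rdiff r R) → Shape (ht L) (ht R) r
rankRule {r} {L} {R} o = shape o refl refl
  where
  height : ∀ c {d} → + d ≡ rdiff r c → d + ht c ≡ suc r
  height c e = Equivalence.to (rdiff≡⇔ r c) (sym e)

  shape : ∀ {a b} → OneOneOrOneTwo a b → a ≡ rdiff r L → b ≡ rdiff r R → Shape (ht L) (ht R) r
  shape d11 eL eR = even (suc-injective (height L eL)) (suc-injective (height R eR))
  shape d12 eL eR = leftTall (suc-injective (height L eL)) (suc-injective (height R eR))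
  shape d21 eL eR = rightTall (suc-injective (height L eL)) (suc-injective (height R eR))

fixLeft-calm : ∀ x pk pr t → ht x ≤ pr → fixLeft x pk pr t ≡ (node x pk pr t , false)
fixLeft-calm leaf               pk pr t _  = refl
fixLeft-calm x@(node _ _ _ _)   pk pr t le
  rewrite isDiff-false 0 pr x (λ e → 1+n≰n (subst (_≤ pr) e le)) = refl

fixRight-calm : ∀ t pk pr x → ht x ≤ pr → fixRight t pk pr x ≡ (node t pk pr x , false)
fixRight-calm t pk pr leaf             _  = refl
fixRight-calm t pk pr x@(node _ _ _ _) le
  rewrite isDiff-false 0 pr x (λ e → 1+n≰n (subst (_≤ pr) e le)) = refl

fixLeft-promote : ∀ x pk pr t → ht x ≡ suc pr → ht t ≡ pr →
                  fixLeft x pk pr t ≡ (node x pk (suc pr) t , false)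
fixLeft-promote x@(node _ _ _ _) pk pr t ex et
  rewrite isDiff-true 0 pr x ex | isDiff-true 1 pr t (cong suc et) = refl

fixRight-promote : ∀ t pk pr x → ht x ≡ suc pr → ht t ≡ pr →
                   fixRight t pk pr x ≡ (node t pk (suc pr) x , false)
fixRight-promote t pk pr x@(node _ _ _ _) ex et
  rewrite isDiff-true 0 pr x ex | isDiff-true 1 pr t (cong suc et) = refl

Promo : ℕ → Tree → Tree → Set
Promo k t t' = insert k t ≡ (t' , false)

promoˡ : ∀ {k l l' x r t s} → k < x → Promo k l l' → fixLeft l' x r t ≡ (s , false) →
         Promo k (node l x r t) s
promoˡ {k} {x = x} k<x el ef rewrite dec-true (k <? x) k<x | el | ef = refl

promoʳ : ∀ {k l x r t t' s} → x < k → Promo k t t' → fixRight l x r t' ≡ (s , false) →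
         Promo k (node l x r t) s
promoʳ {k} {x = x} x<k et ef
  rewrite dec-false (k <? x) (<⇒≯ x<k) | dec-true (x <? k) x<k | et | ef = refl

data Run : Tree → List ℕ → Tree → Set where
  []  : ∀ {t} → Run t [] t
  _∷_ : ∀ {k t t' ks u} → Promo k t t' → Run t' ks u → Run t (k ∷ ks) u

_++ᴿ_ : ∀ {s ks m ks' u} → Run s ks m → Run m ks' u → Run s (ks ++ ks') u
[]       ++ᴿ r' = r'
(e ∷ r)  ++ᴿ r' = e ∷ (r ++ᴿ r')

run-insertAll : ∀ {s ks u} → Run s ks u → insertAll ks s ≡ (u , false)
run-insertAll [] = refl
run-insertAll (e ∷ r) rewrite e | run-insertAll r = refl

data Steady : Tree → List ℕ → Tree → Set where
  []  : ∀ {t} → Steady t [] t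
  _∷_ : ∀ {k t t' ks u} → Promo k t t' × ht t' ≡ ht t → Steady t' ks u → Steady t (k ∷ ks) u

data Rise : Tree → List ℕ → Tree → Set where
  rise : ∀ {k s s' ks u} → Promo k s s' → ht s' ≡ suc (ht s) → Steady s' ks u →
         Rise s (k ∷ ks) u

data Grow : ℕ → Tree → List ℕ → Tree → Set where
  []  : ∀ {t} → Grow 0 t [] t
  _▷_ : ∀ {n s ks m ks' u} → Grow n s ks m → Rise m ks' u → Grow (suc n) s (ks ++ ks') u

_++ˢ_ : ∀ {s ks m ks' u} → Steady s ks m → Steady m ks' u → Steady s (ks ++ ks') u
[]       ++ˢ st' = st'
(e ∷ st) ++ˢ st' = e ∷ (st ++ˢ st')

_↑ˢ_ : ∀ {s ks m ks' u} → Rise s ks m → Steady m ks' u → Rise s (ks ++ ks') u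
rise e h st ↑ˢ st' = rise e h (st ++ˢ st')

steady-height : ∀ {s ks u} → Steady s ks u → ht u ≡ ht s
steady-height []             = refl
steady-height ((_ , h) ∷ st) = trans (steady-height st) h

rise-height : ∀ {s ks u} → Rise s ks u → ht u ≡ suc (ht s)
rise-height (rise _ h st) = trans (steady-height st) h

grow-height : ∀ {n s ks u} → Grow n s ks u → ht u ≡ n + ht s
grow-height []      = refl
grow-height (g ▷ b) = trans (rise-height b) (cong suc (grow-height g))

steady-run : ∀ {s ks u} → Steady s ks u → Run s ks u
steady-run []             = []
steady-run ((e , _) ∷ st) = e ∷ steady-run st

rise-run : ∀ {s ks u} → Rise s ks u → Run s ks u
rise-run (rise e _ st) = e ∷ steady-run st

grow-run : ∀ {n s ks u} → Grow n s ks u → Run s ks u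
grow-run []      = []
grow-run (g ▷ b) = grow-run g ++ᴿ rise-run b

_◁_ : ∀ {n s ks m ks' u} → Rise s ks m → Grow n m ks' u → Grow (suc n) s (ks ++ ks') u
_◁_ {ks = ks} b [] = subst (λ l → Grow 1 _ l _) (sym (++-identityʳ ks)) ([] ▷ b)
_◁_ {ks = ks} b (_▷_ {ks = ks₁} {ks' = ks₂} g b') =
  subst (λ l → Grow _ _ l _) (++-assoc ks ks₁ ks₂) ((b ◁ g) ▷ b')

-- Lifting runs of a subtree to runs of the whole tree.  The keys inserted
-- lie on the side of the subtree, so each insertion descends into it.

steadyˡ : ∀ {L ks L' k r R} → Steady L ks L' → All (_< k) ks → ht L ≤ r →
          Steady (node L k r R) ks (node L' k r R)
steadyˡ [] _ _ = []
steadyˡ {k = k} {r} {R} (_∷_ {t' = L₁} (e , h) st) (k₁<k ∷ ks<k) le =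
  (promoˡ k₁<k e (fixLeft-calm L₁ k r R le₁) , refl) ∷ steadyˡ st ks<k le₁
  where le₁ = subst (_≤ r) (sym h) le

steadyʳ : ∀ {R ks R' k r L} → Steady R ks R' → All (k <_) ks → ht R ≤ r →
          Steady (node L k r R) ks (node L k r R')
steadyʳ [] _ _ = []
steadyʳ {k = k} {r} {L} (_∷_ {t' = R₁} (e , h) st) (k<k₁ ∷ k<ks) le =
  (promoʳ k<k₁ e (fixRight-calm L k r R₁ le₁) , refl) ∷ steadyʳ st k<ks le₁
  where le₁ = subst (_≤ r) (sym h) le

riseʳ-absorb : ∀ {R ks R' k r L} → Rise R ks R' → All (k <_) ks → suc (ht R) ≤ r →
               Steady (node L k r R) ks (node L k r R')
riseʳ-absorb {k = k} {r} {L} (rise {s' = R₁} e h st) (k<k₁ ∷ k<ks) le =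
  (promoʳ k<k₁ e (fixRight-calm L k r R₁ le₁) , refl) ∷ steadyʳ st k<ks le₁
  where le₁ = subst (_≤ r) (sym h) le

riseˡ-promote : ∀ {L ks L' k j R} → Rise L ks L' → All (_< k) ks → ht L ≡ j → ht R ≡ j →
                Rise (node L k j R) ks (node L' k (suc j) R)
riseˡ-promote {k = k} {j} {R} (rise {s' = L₁} e h st) (k₁<k ∷ ks<k) eL eR =
  rise (promoˡ k₁<k e (fixLeft-promote L₁ k j R h₁ eR)) refl (steadyˡ st ks<k (≤-reflexive h₁))
  where h₁ = trans h (cong suc eL)

riseʳ-promote : ∀ {R ks R' k j L} → Rise R ks R' → All (k <_) ks → ht R ≡ j → ht L ≡ j →
                Rise (node L k j R) ks (node L k (suc j) R')
riseʳ-promote {k = k} {j} {L} (rise {s' = R₁} e h st) (k<k₁ ∷ k<ks) eR eL =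
  rise (promoʳ k<k₁ e (fixRight-promote L k j R₁ h₁ eL)) refl (steadyʳ st k<ks (≤-reflexive h₁))
  where h₁ = trans h (cong suc eR)

++-interchange : ∀ (a b c d : List ℕ) → (a ++ b) ++ (c ++ d) ↭ (a ++ c) ++ (b ++ d)
++-interchange a b c d =
  ↭-trans (↭-reflexive (++-assoc a b (c ++ d)))
  (↭-trans (++⁺ˡ a (shifts b c))
  (↭-reflexive (sym (++-assoc a c (b ++ d)))))

++-swapʳ : ∀ (a b c : List ℕ) → (a ++ c) ++ b ↭ (a ++ b) ++ c
++-swapʳ a b c =
  ↭-trans (↭-reflexive (++-assoc a c b))
  (↭-trans (++⁺ˡ a (++-comm c b))
  (↭-reflexive (sym (++-assoc a b c))))

-- Interleaving n rises of two equally tall children, level by level: the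
-- left rise promotes the parent, then the right rise is absorbed.
interleave : ∀ {n L₀ ksL L R₀ ksR R k} → Grow n L₀ ksL L → Grow n R₀ ksR R → ht R₀ ≡ ht L₀ →
             All (_< k) ksL → All (k <_) ksR →
             Σ (List ℕ) λ ks → (ks ↭ ksL ++ ksR) ×
               Grow n (node L₀ k (ht L₀) R₀) ks (node L k (n + ht L₀) R)
interleave [] [] _ _ _ = [] , ↭-refl , []
interleave {n = suc n} {L₀} (_▷_ {ks = ksL} {ks' = bl} gL bL) (_▷_ {ks = ksR} {ks' = br} gR bR) e aL aR
  with ++⁻ ksL aL | ++⁻ ksR aR
... | aL₁ , abL | aR₁ , abR
  with interleave gL gR e aL₁ aR₁
... | ks , p , g =
  ks ++ (bl ++ br) ,
  ↭-trans (++⁺ʳ (bl ++ br) p) (++-interchange ksL ksR bl br) ,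
  g ▷ (riseˡ-promote bL abL hL hR ↑ˢ riseʳ-absorb bR abR (≤-reflexive (cong suc hR)))
  where
  hL : ht _ ≡ n + ht L₀
  hL = grow-height gL
  hR : ht _ ≡ n + ht L₀
  hR = trans (grow-height gR) (cong (λ h → n + h) e)

-- Inserting the first key into the empty tree is a rise; prefix it to the
-- rises built above the single root node (whose ranks come out as h + 0).
rootFirst : ∀ {n ks L k h R} → Grow n (node leaf k 0 leaf) ks (node L k (h + 0) R) →
            Grow (suc n) leaf (k ∷ ks) (node L k h R)
rootFirst {L = L} {k} {h} {R} g =
  subst (λ ρ → Grow _ leaf _ (node L k ρ R)) (+-identityʳ h) (rise refl refl [] ◁ g)

-- Building a node whose children obey the rank rule: insert the root key,
-- interleave the rises of both children, and finish with the extra rise of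
-- the taller child, if any.
growNode : ∀ {n m r L R ksL ksR k} → Shape n m r → Grow n leaf ksL L → Grow m leaf ksR R →
           All (_< k) ksL → All (k <_) ksR →
           Σ (List ℕ) λ ks → (ks ↭ ksL ++ ksR) × Grow (suc r) leaf (k ∷ ks) (node L k r R)
growNode (even refl refl) gL gR aL aR with interleave gL gR refl aL aR
... | ks , p , g = ks , p , rootFirst g
growNode {ksR = ksR} (leftTall refl refl) (_▷_ {ks = ksL} {ks' = bl} gL bL) gR aL aR
  with ++⁻ ksL aL
... | aL₁ , abL with interleave gL gR refl aL₁ aR
... | ks , p , g =
  ks ++ bl , ↭-trans (++⁺ʳ bl p) (++-swapʳ ksL bl ksR) ,
  rootFirst (g ▷ riseˡ-promote bL abL (grow-height gL) (grow-height gR))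
growNode {ksL = ksL} (rightTall refl refl) gL (_▷_ {ks = ksR} {ks' = br} gR bR) aL aR
  with ++⁻ ksR aR
... | aR₁ , abR with interleave gL gR refl aL aR₁
... | ks , p , g =
  ks ++ br , ↭-trans (++⁺ʳ br p) (↭-reflexive (++-assoc ksL ksR br)) ,
  rootFirst (g ▷ riseʳ-promote bR abR (grow-height gR) (grow-height gL))

sorted-head : ∀ {x ys} → Sorted (x ∷ ys) → All (x <_) ys
sorted-head [ _ ]     = []
sorted-head (x<y ∷ s) = x<y ∷ map (<-trans x<y) (sorted-head s)

sorted-tail : ∀ {x ys} → Sorted (x ∷ ys) → Sorted ys
sorted-tail [ _ ]   = []
sorted-tail (_ ∷ s) = s

sorted-split : ∀ xs {k ys} → Sorted (xs ++ k ∷ ys) → Sorted xs × All (_< k) xs × Sorted (k ∷ ys)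
sorted-split []           s         = [] , [] , s
sorted-split (x ∷ [])     (x<k ∷ s) = [ x ] , x<k ∷ [] , s
sorted-split (x ∷ y ∷ xs) (x<y ∷ s) with sorted-split (y ∷ xs) s
... | sxs , y<k ∷ xs<k , sk = (x<y ∷ sxs) , <-trans x<y y<k ∷ y<k ∷ xs<k , sk

growOrder : ∀ T → AVL T → Σ (List ℕ) λ ks → (ks ↭ keys T) × Grow (ht T) leaf ks T
growOrder leaf _ = [] , ↭-refl , []
growOrder (node L k r R) (sorted , node avlL avlR rule)
  with sorted-split (keys L) sorted
... | sortedL , L<k , sortedkR
  with growOrder L (sortedL , avlL) | growOrder R (sorted-tail sortedkR , avlR)
... | ksL , pL , gL | ksR , pR , gR
  with growNode (rankRule rule) gL gR (All-resp-↭ (↭-sym pL) L<k)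
                (All-resp-↭ (↭-sym pR) (sorted-head sortedkR))
... | ks , p , g =
  k ∷ ks , ↭-trans (prep k (↭-trans p (++⁺ pL pR)))
                   (↭-sym (shift k (keys L) (keys R))) , g

theorem1 : (T : Tree) → AVL T →
    Σ (List ℕ) (λ ks → (ks ↭ keys T) × (insertAll ks leaf ≡ (T , false)))
theorem1 T avl with growOrder T avl
... | ks , p , g = ks , p , run-insertAll (grow-run g)
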